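{- Let $\mathbb{G}=(V,E,T)$ be a temporal graph and $\Delta\in\mathbb{N}$. If the procedure $\textsc{BronKerboschDelta}(P,R,X)$ described in the context is run on input $P=V\times\{T\}$, $R=(\emptyset,T)$, $X=\emptyset$, then it adds all maximal $\Delta$-cliques of $\mathbb{G}$, and only these, to the solution.
   Context: A temporal graph $\mathbb{G}=(V,E,T)$ consists of a finite vertex set $V$, an integer time interval $T=[\alpha,\omega]$, and a set of time-edges $E\subseteq\binom{V}{2}\times T$. All intervals are intervals of integers; for an interval $J=[a,b]$ write $|J|=b-a$. A $\Delta$-clique is a tuple $(C,I=[a,b])$ with $C\subseteq V$, $b-a\ge\Delta$, $I\subseteq T$, such that for all $\tau\in[a,b-\Delta]$ and all distinct $v,w\in C$ there is $(\{v,w\},t)\in E$ with $t\in[\tau,\tau+\Delta]$. It is vertex-maximal if there is no $\Delta$-clique $(C',I')$ with $I\subseteq I'$ and $C\subsetneq C'$; time-maximal if there is no $\Delta$-clique $(C',I')$ with $I\subsetneq I'$ and $C\subseteq C'$; maximal if both. A vertex-interval pair is a tuple $(v,I)$ with $v\in V$, $I\subseteq T$ an interval. $\Delta$-neighborhood: $N^{\Delta}(v,I)$ is the set of all $(w,I'=[a',b'])$ such that $b'-a'\ge\Delta$, $I'\subseteq I$, for every $\tau\in[a',b'-\Delta]$ there is $(\{v,w\},t)\in E$ with $t\in[\tau,\tau+\Delta]$, and $I'$ is inclusion-maximal among subintervals of $I$ with these properties. $\Delta$-cut: $Y\sqcap Z=\{(v,I\cap I')\mid (v,I)\in Y,\ (v,I')\in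 Z,\ |I\cap I'|\ge\Delta\}$. Procedure $\textsc{BronKerboschDelta}(P,R=(C,I),X)$, with $P,X$ sets of vertex-interval pairs: (1) if every $(w,I')\in P\cup X$ satisfies $I'\subsetneq I$, add $R$ to the solution; (2) for each $(v,I')\in P$ (iterating over the current $P$): set $R'=(C\cup\{v\},I')$, $P'=P\sqcap N^{\Delta}(v,I')$, $X'=X\sqcap N^{\Delta}(v,I')$, call $\textsc{BronKerboschDelta}(P',R',X')$, then remove $(v,I')$ from $P$ and add it to $X$. -}

module Defs where

open import Level using (0ℓ)
open import Data.Nat using (ℕ)
open import Data.Integer using (ℤ; +_; _+_; _-_; _≤_; _⊔_; _⊓_)
open import Data.Fin using (Fin)
open import Data.Fin.Subset as Sub using (Subset; ⁅_⁆; _∪_)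
open import Data.List using (List; []; _∷_; _++_)
open import Data.List.Relation.Unary.All using (All)
open import Data.List.Relation.Unary.Any using (Any)
open import Data.Product using (_×_; _,_; proj₁; proj₂; ∃; ∃-syntax; Σ)
open import Data.Sum using (_⊎_)
open import Data.Empty using (⊥)
open import Relation.Nullary using (¬_)
open import Relation.Binary.PropositionalEquality using (_≡_; _≢_)

-- Temporal graphs G = (V, E, T) with V = Fin n, T = [α, ω] ⊆ ℤ.
-- A time-edge ({x,y},t) is stored as a triple (x , y , t); the
-- orientation is irrelevant (see HasEdge).  Well-formedness: x ≠ y
-- (edges are 2-element subsets of V) and t ∈ T.

record TemporalGraph : Set where
  field
    n    : ℕ
    α    : ℤ
    ω    : ℤ
    E    : List (Fin n × Fin n × ℤ)
    E-wf : All (λ e → (proj₁ e ≢ proj₁ (proj₂ e))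
                       × (α ≤ proj₂ (proj₂ e)) × (proj₂ (proj₂ e) ≤ ω)) E

Interval : Set
Interval = ℤ × ℤ

_∈ᵢ_ : ℤ → Interval → Set
t ∈ᵢ (a , b) = (a ≤ t) × (t ≤ b)

_⊆ᵢ_ : Interval → Interval → Set
I ⊆ᵢ J = ∀ t → t ∈ᵢ I → t ∈ᵢ J

_⊊ᵢ_ : Interval → Interval → Set
I ⊊ᵢ J = (I ⊆ᵢ J) × ¬ (J ⊆ᵢ I)

len : Interval → ℤ
len (a , b) = b - a

_∩ᵢ_ : Interval → Interval → Interval
(a , b) ∩ᵢ (a' , b') = (a ⊔ a' , b ⊓ b')

module _ (G : TemporalGraph) (Δ : ℕ) where
  open TemporalGraph G

  V : Set
  V = Fin n

  T : Interval
  T = (α , ω)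

  HasEdge : V → V → ℤ → Set
  HasEdge v w t =
    Any (λ e → (proj₂ (proj₂ e) ≡ t)
               × (((proj₁ e ≡ v) × (proj₁ (proj₂ e) ≡ w))
                  ⊎ ((proj₁ e ≡ w) × (proj₁ (proj₂ e) ≡ v)))) E

  Linked : V → V → Interval → Set
  Linked v w (a , b) =
    ∀ τ → τ ∈ᵢ (a , b - + Δ) → ∃[ t ] (HasEdge v w t × t ∈ᵢ (τ , τ + + Δ))

  Clq : Set
  Clq = Subset n × Interval

  IsΔClique : Clq → Set
  IsΔClique (C , I) =
    (+ Δ ≤ len I) × (I ⊆ᵢ T)
    × (∀ v w → v Sub.∈ C → w Sub.∈ C → v ≢ w → Linked v w I)

  VertexMaximal : Clq → Set
  VertexMaximal (C , I) =
    IsΔClique (C , I)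
    × (∀ C' I' → IsΔClique (C' , I') → I ⊆ᵢ I' → ¬ (C Sub.⊂ C'))

  TimeMaximal : Clq → Set
  TimeMaximal (C , I) =
    IsΔClique (C , I)
    × (∀ C' I' → IsΔClique (C' , I') → I ⊊ᵢ I' → ¬ (C Sub.⊆ C'))

  MaximalΔClique : Clq → Set
  MaximalΔClique K = VertexMaximal K × TimeMaximal K

  VI : Set
  VI = V × Interval

  VISet : Set₁
  VISet = VI → Set

  N : V → Interval → VISet
  N v I (w , I') =
    (+ Δ ≤ len I') × (I' ⊆ᵢ I) × Linked v w I'
    × (∀ J → + Δ ≤ len J → J ⊆ᵢ I → Linked v w J → I' ⊆ᵢ J → J ⊆ᵢ I')

  _⊓Δ_ : VISet → VISet → VISet
  (Y ⊓Δ Z) (v , J) =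
    ∃[ I ] ∃[ I' ] (Y (v , I) × Z (v , I') × (J ≡ I ∩ᵢ I') × (+ Δ ≤ len J))

  _∖ₛ_ : VISet → VI → VISet
  (P ∖ₛ x) y = P y × (y ≢ x)

  _∪ₛ_ : VISet → VI → VISet
  (X ∪ₛ x) y = X y ⊎ (y ≡ x)

  ReportCond : VISet → Clq → VISet → Set
  ReportCond P (C , I) X = ∀ w I' → (P (w , I') ⊎ X (w , I')) → I' ⊊ᵢ I

  -- Executions of BronKerboschDelta (big-step, nondeterministic in the
  -- order in which the loop picks elements of P).
  -- BK P R X out : running BronKerboschDelta(P,R,X) can add exactly the
  --   list out of cliques (in order) to the solution.
  -- Loop P R X out : running the for-loop of step (2) on the current P, X.

  data BK : VISet → Clq → VISet → List Clq → Set₁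
  data Loop : VISet → Clq → VISet → List Clq → Set₁

  data BK where
    bk-report : ∀ {P R X out} → ReportCond P R X → Loop P R X out
              → BK P R X (R ∷ out)
    bk-skip   : ∀ {P R X out} → ¬ ReportCond P R X → Loop P R X out
              → BK P R X out

  data Loop where
    loop-done : ∀ {P R X} → (∀ y → ¬ P y) → Loop P R X []
    loop-step : ∀ {P C I X out₁ out₂} (v : V) (I' : Interval)
              → P (v , I')
              → BK (P ⊓Δ N v I') (C ∪ ⁅ v ⁆ , I') (X ⊓Δ N v I') out₁
              → Loop (P ∖ₛ (v , I')) (C , I) (X ∪ₛ (v , I')) out₂
              → Loop P (C , I) X (out₁ ++ out₂)

  P₀ : VISet
  P₀ (v , I) = I ≡ T

  R₀ : Clq
  R₀ = (Sub.⊥ , T)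

  X₀ : VISet
  X₀ _ = ⊥

module Submission where

-- The proof maintains two invariants along every run.  Soundness: the current
-- R = (C, I) is a time-maximal clique, P ∪ X consists of pairs (w, J) with J a
-- maximal subinterval of I on which w is Δ-linked to all of C, and every such
-- linked subinterval lies inside one of them; so when the report condition holds,
-- no vertex can be added and R is maximal.  Completeness: for a fixed maximal
-- clique (KC, KI), once C ⊆ KC and KI ⊆ I, every missing vertex of KC sits in P
-- with an interval containing KI and never in X; following the branch that adds
-- such a vertex with an interval containing KI ends in a call with R = (KC, KI),
-- which must report.  The geometric input is that linked intervals overlapping in
-- a subinterval of length ≥ Δ glue to their hull, and that every linked interval
-- extends to a maximal one.

open import Defs
open import Data.Nat using (ℕ)
open import Data.Integer using (+_; _-_; _≤_)
open import Data.List using (List)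
open import Data.List.Membership.Propositional using (_∈_)
open import Data.Product using (_×_)
open import Function.Bundles using (_⇔_; mk⇔)

open import Data.Nat using (zero; suc)
open import Data.Integer using (ℤ; _+_; -_; _⊔_; _⊓_; ∣_∣; pred; 1ℤ; -1ℤ) renaming (suc to sucℤ)
open import Data.Integer.Properties
open import Data.Integer.Tactic.RingSolver using (solve-∀)
open import Data.Fin using (Fin)
import Data.Fin.Properties as Fin
open import Data.Fin.Subset using (Subset; ⁅_⁆; _∪_) renaming (⊥ to ∅; _∈_ to _∈ₛ_; _∉_ to _∉ₛ_; _⊆_ to _⊆ₛ_; _⊂_ to _⊂ₛ_)
open import Data.Fin.Subset.Properties using (x∈p∪q⁻; x∈p∪q⁺; x∈⁅x⁆; x∈⁅y⁆⇒x≡y; ∉⊥; _∈?_; _⊆?_; ⊆-antisym)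
open import Data.List.Membership.Propositional using (find; lose)
open import Data.List.Relation.Unary.All using (lookup)
open import Data.List.Relation.Unary.Any as Any using (any?; here; there)
open import Data.List.Membership.Propositional.Properties using (∈-++⁻; ∈-++⁺ˡ; ∈-++⁺ʳ)
open import Data.Product.Properties using (≡-dec)
open import Data.Product using (∃-syntax; _,_; proj₁; proj₂)
open import Data.Sum as Sum using (_⊎_; inj₁; inj₂; [_,_]′)
open import Relation.Nullary.Decidable using (_×-dec_; _⊎-dec_; _→-dec_; map′; decidable-stable)
open import Function using (_∘_; const)
open import Relation.Nullary using (¬_; Dec; yes; no; contradiction)
open import Relation.Binary.PropositionalEquality using (_≡_; _≢_; refl; sym; trans; cong; cong₂; subst)

private
  variable
    Δ : ℕ
    i j k a b c d p q τ : ℤ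
    I J K L : Interval
    Lk : Interval → Set
    m : ℕ
    x y : Fin m
    C : Subset m

i≤j-k⇒k+i≤j : ∀ k → i ≤ j - k → k + i ≤ j
i≤j-k⇒k+i≤j {i} {j} k h = ≤-trans (+-monoʳ-≤ k h) (≤-reflexive (k+[j-k]≡j k j))
  where
  k+[j-k]≡j : ∀ k j → k + (j - k) ≡ j
  k+[j-k]≡j = solve-∀

k+i≤j⇒i≤j-k : ∀ k → k + i ≤ j → i ≤ j - k
k+i≤j⇒i≤j-k {i} {j} k h = ≤-trans (≤-reflexive (sym ([k+i]-k≡i k i))) (+-monoˡ-≤ (- k) h)
  where
  [k+i]-k≡i : ∀ k i → (k + i) - k ≡ i
  [k+i]-k≡i = solve-∀

≰⇒suc≤ : ¬ (i ≤ j) → sucℤ j ≤ i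
≰⇒suc≤ = i<j⇒suc[i]≤j ∘ ≰⇒>

-- pred and suc written out, so that the ring solver can read them.
pred[i+suc[j]]≡i+j : ∀ i j → -1ℤ + (i + (1ℤ + j)) ≡ i + j
pred[i+suc[j]]≡i+j = solve-∀

i+suc[j]≡suc[i]+j : ∀ i j → i + (1ℤ + j) ≡ (1ℤ + i) + j
i+suc[j]≡suc[i]+j = solve-∀

i≤j⇒j≡i+∣j-i∣ : i ≤ j → j ≡ i + + ∣ j - i ∣
i≤j⇒j≡i+∣j-i∣ {i} {j} i≤j =
  trans (sym (i+[j-i]≡j i j)) (cong (λ x → i + x) (sym (0≤i⇒+∣i∣≡i (i≤j⇒0≤j-i i≤j))))
  where
  i+[j-i]≡j : ∀ i j → i + (j - i) ≡ j
  i+[j-i]≡j = solve-∀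

≤⊔⇒≤⊎≤ : i ≤ j ⊔ k → i ≤ j ⊎ i ≤ k
≤⊔⇒≤⊎≤ {i} {j} {k} h with ≤-total j k
... | inj₁ j≤k = inj₂ (subst (i ≤_) (i≤j⇒i⊔j≡j j≤k) h)
... | inj₂ k≤j = inj₁ (subst (i ≤_) (i≥j⇒i⊔j≡i k≤j) h)

⊓≤⇒≤⊎≤ : j ⊓ k ≤ i → j ≤ i ⊎ k ≤ i
⊓≤⇒≤⊎≤ {j} {k} {i} h with ≤-total j k
... | inj₁ j≤k = inj₁ (subst (_≤ i) (i≤j⇒i⊓j≡i j≤k) h)
... | inj₂ k≤j = inj₂ (subst (_≤ i) (i≥j⇒i⊓j≡j k≤j) h)

Wide : ℕ → Interval → Set
Wide Δ I = + Δ ≤ len I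

hull : Interval → Interval → Interval
hull (a , b) (c , d) = (a ⊓ c , b ⊔ d)

wide⇒+≤ : Wide Δ (a , b) → a + + Δ ≤ b
wide⇒+≤ {a = a} = i≤j-k⇒k+i≤j a

+≤⇒wide : a + + Δ ≤ b → Wide Δ (a , b)
+≤⇒wide {a = a} = k+i≤j⇒i≤j-k a

wide⇒window : Wide Δ (a , b) → a ≤ b - + Δ
wide⇒window {Δ} {a} {b} h = k+i≤j⇒i≤j-k (+ Δ) (subst (_≤ b) (+-comm a (+ Δ)) (wide⇒+≤ h))

wide⇒≤ : Wide Δ (a , b) → a ≤ b
wide⇒≤ {Δ} {b = b} h = ≤-trans (wide⇒window {b = b} h) (i-j≤i b (+ Δ))

⊆ᵢ-refl : I ⊆ᵢ I
⊆ᵢ-refl _ t∈I = t∈I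

⊆ᵢ-trans : I ⊆ᵢ J → J ⊆ᵢ K → I ⊆ᵢ K
⊆ᵢ-trans I⊆J J⊆K t = J⊆K t ∘ I⊆J t

⊆ᵢ⇒bounds : a ≤ b → (a , b) ⊆ᵢ (c , d) → c ≤ a × b ≤ d
⊆ᵢ⇒bounds a≤b ab⊆cd = proj₁ (ab⊆cd _ (≤-refl , a≤b)) , proj₂ (ab⊆cd _ (a≤b , ≤-refl))

bounds⇒⊆ᵢ : c ≤ a → b ≤ d → (a , b) ⊆ᵢ (c , d)
bounds⇒⊆ᵢ c≤a b≤d t (a≤t , t≤b) = ≤-trans c≤a a≤t , ≤-trans t≤b b≤d

_⊆ᵢ?_ : ∀ I J → Dec (I ⊆ᵢ J)
(a , b) ⊆ᵢ? (c , d) with a ≤? b | c ≤? a | b ≤? d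
... | no a≰b | _ | _ = yes (λ t (a≤t , t≤b) → contradiction (≤-trans a≤t t≤b) a≰b)
... | yes a≤b | yes c≤a | yes b≤d = yes (bounds⇒⊆ᵢ c≤a b≤d)
... | yes a≤b | no c≰a | _ = no (c≰a ∘ proj₁ ∘ ⊆ᵢ⇒bounds a≤b)
... | yes a≤b | _ | no b≰d = no (b≰d ∘ proj₂ ∘ ⊆ᵢ⇒bounds a≤b)

⊆ᵢ-antisym : Wide Δ I → Wide Δ J → I ⊆ᵢ J → J ⊆ᵢ I → I ≡ J
⊆ᵢ-antisym {I = a , b} {J = c , d} I-wide J-wide I⊆J J⊆I =
  cong₂ _,_ (≤-antisym (proj₁ (⊆ᵢ⇒bounds (wide⇒≤ J-wide) J⊆I)) (proj₁ (⊆ᵢ⇒bounds (wide⇒≤ I-wide) I⊆J)))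
            (≤-antisym (proj₂ (⊆ᵢ⇒bounds (wide⇒≤ I-wide) I⊆J)) (proj₂ (⊆ᵢ⇒bounds (wide⇒≤ J-wide) J⊆I)))

Wide-mono : Wide Δ I → I ⊆ᵢ J → Wide Δ J
Wide-mono {Δ} {I = a , b} I-wide I⊆J with ⊆ᵢ⇒bounds (wide⇒≤ I-wide) I⊆J
... | c≤a , b≤d = +≤⇒wide (≤-trans (+-monoˡ-≤ (+ Δ) c≤a) (≤-trans (wide⇒+≤ I-wide) b≤d))

⊆ᵢ-touch : Wide Δ K → K ⊆ᵢ (a , b) → K ⊆ᵢ (c , d) → a ≤ d - + Δ
⊆ᵢ-touch {Δ} {K = p , q} K-wide K⊆ab K⊆cd =
  ≤-trans (proj₁ (⊆ᵢ⇒bounds p≤q K⊆ab))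
    (≤-trans (wide⇒window {b = q} K-wide) (+-monoˡ-≤ (- + Δ) (proj₂ (⊆ᵢ⇒bounds p≤q K⊆cd))))
  where p≤q = wide⇒≤ {b = q} K-wide

⊆ᵢ-hullˡ : ∀ I J → I ⊆ᵢ hull I J
⊆ᵢ-hullˡ (a , b) (c , d) t (a≤t , t≤b) = ≤-trans (i⊓j≤i a c) a≤t , ≤-trans t≤b (i≤i⊔j b d)

⊆ᵢ-hullʳ : ∀ I J → J ⊆ᵢ hull I J
⊆ᵢ-hullʳ (a , b) (c , d) t (c≤t , t≤d) = ≤-trans (i⊓j≤j a c) c≤t , ≤-trans t≤d (i≤j⊔i b d)

hull-least : Wide Δ I → Wide Δ J → I ⊆ᵢ K → J ⊆ᵢ K → hull I J ⊆ᵢ K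
hull-least {I = a , b} {J = c , d} I-wide J-wide I⊆K J⊆K
  with ⊆ᵢ⇒bounds (wide⇒≤ I-wide) I⊆K | ⊆ᵢ⇒bounds (wide⇒≤ J-wide) J⊆K
... | e≤a , b≤f | e≤c , d≤f = bounds⇒⊆ᵢ (⊓-glb e≤a e≤c) (⊔-lub b≤f d≤f)

∈ᵢ-hull : c ≤ b → a ≤ d → τ ∈ᵢ hull (a , b) (c , d) → τ ∈ᵢ (a , b) ⊎ τ ∈ᵢ (c , d)
∈ᵢ-hull {c} {b} {a} {d} {τ} c≤b a≤d (lo , hi) with ⊓≤⇒≤⊎≤ lo | ≤⊔⇒≤⊎≤ hi
... | inj₁ a≤τ | inj₁ τ≤b = inj₁ (a≤τ , τ≤b)
... | inj₂ c≤τ | inj₂ τ≤d = inj₂ (c≤τ , τ≤d)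
... | inj₁ a≤τ | inj₂ τ≤d with ≤-total τ b
...   | inj₁ τ≤b = inj₁ (a≤τ , τ≤b)
...   | inj₂ b≤τ = inj₂ (≤-trans c≤b b≤τ , τ≤d)
∈ᵢ-hull {c} {b} {a} {d} {τ} c≤b a≤d (lo , hi) | inj₂ c≤τ | inj₁ τ≤b with ≤-total a τ
...   | inj₁ a≤τ = inj₁ (a≤τ , τ≤b)
...   | inj₂ τ≤a = inj₂ (c≤τ , ≤-trans τ≤a a≤d)

∩ᵢ-⊆ˡ : ∀ I J → (I ∩ᵢ J) ⊆ᵢ I
∩ᵢ-⊆ˡ (a , b) (c , d) t (lo , hi) = ≤-trans (i≤i⊔j a c) lo , ≤-trans hi (i⊓j≤i b d)

∩ᵢ-⊆ʳ : ∀ I J → (I ∩ᵢ J) ⊆ᵢ J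
∩ᵢ-⊆ʳ (a , b) (c , d) t (lo , hi) = ≤-trans (i≤j⊔i a c) lo , ≤-trans hi (i⊓j≤j b d)

∩ᵢ-greatest : L ⊆ᵢ I → L ⊆ᵢ J → L ⊆ᵢ (I ∩ᵢ J)
∩ᵢ-greatest L⊆I L⊆J t t∈L =
  ⊔-lub (proj₁ (L⊆I t t∈L)) (proj₁ (L⊆J t t∈L)) , ⊓-glb (proj₂ (L⊆I t t∈L)) (proj₂ (L⊆J t t∈L))

module _ {Q : ℤ → Set} where

  least-above : (∀ {c} → Q c → Dec (Q (pred c))) → p ≤ a → Q a
              → ∃[ c ] (p ≤ c × c ≤ a × Q c × (c ≡ p ⊎ ¬ Q (pred c)))
  least-above {p} Q? p≤a = go _ (i≤j⇒j≡i+∣j-i∣ p≤a)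
    where
    go : ∀ k → a ≡ p + + k → Q a → ∃[ c ] (p ≤ c × c ≤ a × Q c × (c ≡ p ⊎ ¬ Q (pred c)))
    go {a} zero a≡p+0 Qa = a , ≤-reflexive (sym a≡p) , ≤-refl , Qa , inj₁ a≡p
      where a≡p = trans a≡p+0 (+-identityʳ p)
    go {a} (suc k) a≡ Qa with Q? Qa
    ... | no ¬Q = a , subst (p ≤_) (sym a≡) (i≤i+j p (+ suc k)) , ≤-refl , Qa , inj₂ ¬Q
    ... | yes Q′ with go k (trans (cong pred a≡) (pred[i+suc[j]]≡i+j p (+ k))) Q′
    ...   | c , p≤c , c≤a-1 , Qc , stop = c , p≤c , ≤-trans c≤a-1 (i≤j⇒pred[i]≤j ≤-refl) , Qc , stop

  greatest-below : (∀ {d} → Q d → Dec (Q (sucℤ d))) → b ≤ q → Q b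
                 → ∃[ d ] (b ≤ d × d ≤ q × Q d × (d ≡ q ⊎ ¬ Q (sucℤ d)))
  greatest-below {q = q} Q? b≤q = go _ (i≤j⇒j≡i+∣j-i∣ b≤q)
    where
    go : ∀ k → q ≡ b + + k → Q b → ∃[ d ] (b ≤ d × d ≤ q × Q d × (d ≡ q ⊎ ¬ Q (sucℤ d)))
    go {b} zero q≡b+0 Qb = b , ≤-refl , ≤-reflexive b≡q , Qb , inj₁ b≡q
      where b≡q = sym (trans q≡b+0 (+-identityʳ b))
    go {b} (suc k) q≡ Qb with Q? Qb
    ... | no ¬Q = b , ≤-refl , subst (b ≤_) (sym q≡) (i≤i+j b (+ suc k)) , Qb , inj₂ ¬Q
    ... | yes Q′ with go k (trans q≡ (i+suc[j]≡suc[i]+j b (+ k))) Q′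
    ...   | d , b+1≤d , d≤q , Qd , stop = d , ≤-trans (i≤suc[i] b) b+1≤d , d≤q , Qd , stop

x∈p∪⁅y⁆⁻ : x ∈ₛ C ∪ ⁅ y ⁆ → x ∈ₛ C ⊎ x ≡ y
x∈p∪⁅y⁆⁻ {C = C} {y = y} = Sum.map₂ (x∈⁅y⁆⇒x≡y y) ∘ x∈p∪q⁻ C ⁅ y ⁆

x∈p⇒x∈p∪⁅y⁆ : x ∈ₛ C → x ∈ₛ C ∪ ⁅ y ⁆
x∈p⇒x∈p∪⁅y⁆ = x∈p∪q⁺ ∘ inj₁

y∈p∪⁅y⁆ : y ∈ₛ C ∪ ⁅ y ⁆
y∈p∪⁅y⁆ {y = y} = x∈p∪q⁺ (inj₂ (x∈⁅x⁆ y))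

⊈⇒∃∉ : ∀ {p q : Subset m} → ¬ (p ⊆ₛ q) → ∃[ x ] (x ∈ₛ p × x ∉ₛ q)
⊈⇒∃∉ {m} {p} {q} p⊈q
  with Fin.¬∀⟶∃¬ m (λ x → x ∈ₛ p → x ∈ₛ q) (λ x → x ∈? p →-dec x ∈? q) (λ f → p⊈q (f _))
... | x , x∈p↛x∈q with x ∈? p
...   | yes x∈p = x , x∈p , x∈p↛x∈q ∘ const
...   | no x∉p = contradiction (λ x∈p → contradiction x∈p x∉p) x∈p↛x∈q

module _ (Δ : ℕ) where

  Glues : (Interval → Set) → Set
  Glues Lk = ∀ {I J K} → Wide Δ K → K ⊆ᵢ I → K ⊆ᵢ J → Lk I → Lk J → Lk (hull I J)

  MaximalIn : (Interval → Set) → Interval → Interval → Set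
  MaximalIn Lk J I =
    Wide Δ J × J ⊆ᵢ I × Lk J × (∀ L → Wide Δ L → L ⊆ᵢ I → Lk L → J ⊆ᵢ L → L ⊆ᵢ J)

  MaximalIn-absorb : Glues Lk → MaximalIn Lk J I → Wide Δ L → L ⊆ᵢ I → Lk L
                   → Wide Δ K → K ⊆ᵢ L → K ⊆ᵢ J → L ⊆ᵢ J
  MaximalIn-absorb {J = J} {L = L} glue (J-wide , J⊆I , LkJ , J-max) L-wide L⊆I LkL K-wide K⊆L K⊆J =
    ⊆ᵢ-trans (⊆ᵢ-hullˡ L J)
      (J-max (hull L J) (Wide-mono J-wide (⊆ᵢ-hullʳ L J)) (hull-least L-wide J-wide L⊆I J⊆I)
             (glue K-wide K⊆L K⊆J LkL LkJ) (⊆ᵢ-hullʳ L J))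

module _ (G : TemporalGraph) (Δ : ℕ) where
  open TemporalGraph G using (n; E; E-wf)

  private
    variable
      v w : Fin n
      C′ KC : Subset n
      I′ KI M : Interval
      P X Y Z : VISet G Δ
      out : List (Clq G Δ)

  EdgeIn : Fin n → Fin n → Interval → Set
  EdgeIn v w I = ∃[ t ] (HasEdge G Δ v w t × t ∈ᵢ I)

  EdgeIn? : ∀ v w I → Dec (EdgeIn v w I)
  EdgeIn? v w I = map′ from to (any? matches? E)
    where
    Ends : Fin n → Fin n → Set
    Ends x y = (x ≡ v × y ≡ w) ⊎ (x ≡ w × y ≡ v)
    Matches : Fin n × Fin n × ℤ → Set
    Matches (x , y , t) = Ends x y × t ∈ᵢ I
    matches? : ∀ e → Dec (Matches e)
    matches? (x , y , t) = ((x Fin.≟ v ×-dec y Fin.≟ w) ⊎-dec (x Fin.≟ w ×-dec y Fin.≟ v))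
                           ×-dec ((proj₁ I ≤? t) ×-dec (t ≤? proj₂ I))
    from : Any.Any Matches E → EdgeIn v w I
    from m with find m
    ... | _ , e∈E , ends , t∈I = _ , lose e∈E (refl , ends) , t∈I
    to : EdgeIn v w I → Any.Any Matches E
    to (t , e∈ , t∈I) with find e∈
    ... | _ , e∈E , refl , ends = lose e∈E (ends , t∈I)

  HasEdge-sym : ∀ {t} → HasEdge G Δ v w t → HasEdge G Δ w v t
  HasEdge-sym = Any.map (Data.Product.map₂ Sum.swap)

  HasEdge-irrefl : ∀ {t} → ¬ HasEdge G Δ v v t
  HasEdge-irrefl e with find e
  ... | _ , e∈E , _ , inj₁ (x≡v , y≡v) = proj₁ (lookup E-wf e∈E) (trans x≡v (sym y≡v))
  ... | _ , e∈E , _ , inj₂ (x≡v , y≡v) = proj₁ (lookup E-wf e∈E) (trans x≡v (sym y≡v))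

  Linked-sym : Linked G Δ v w I → Linked G Δ w v I
  Linked-sym l τ τ∈ with l τ τ∈
  ... | t , e , t∈ = t , HasEdge-sym e , t∈

  Linked-irrefl : Wide Δ I → ¬ Linked G Δ v v I
  Linked-irrefl {I = a , b} I-wide l =
    HasEdge-irrefl (proj₁ (proj₂ (l a (≤-refl , wide⇒window {b = b} I-wide))))

  Linked-⊆ᵢ : I ⊆ᵢ J → Linked G Δ v w J → Linked G Δ v w I
  Linked-⊆ᵢ {I = a , b} I⊆J l τ (a≤τ , τ≤b-Δ)
    with ⊆ᵢ⇒bounds (≤-trans a≤τ (≤-trans τ≤b-Δ (i-j≤i b (+ Δ)))) I⊆J
  ... | c≤a , b≤d = l τ (≤-trans c≤a a≤τ , ≤-trans τ≤b-Δ (+-monoˡ-≤ (- + Δ) b≤d))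

  -- Both windows [a, b - Δ] reach across K, so together they cover the window of the hull.
  Linked-glues : Glues Δ (Linked G Δ v w)
  Linked-glues {I = a₁ , b₁} {J = a₂ , b₂} K-wide K⊆I K⊆J l₁ l₂ τ (lo , hi)
    with ∈ᵢ-hull (⊆ᵢ-touch K-wide K⊆J K⊆I) (⊆ᵢ-touch K-wide K⊆I K⊆J)
                 (lo , subst (τ ≤_) (mono-≤-distrib-⊔ (+-monoˡ-≤ (- + Δ)) b₁ b₂) hi)
  ... | inj₁ τ∈₁ = l₁ τ τ∈₁
  ... | inj₂ τ∈₂ = l₂ τ τ∈₂

  Linked-vacuous : ¬ (a ≤ b - + Δ) → Linked G Δ v w (a , b)
  Linked-vacuous a≰b-Δ τ (a≤τ , τ≤b-Δ) = contradiction (≤-trans a≤τ τ≤b-Δ) a≰b-Δ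

  Linked-extendˡ : EdgeIn v w (pred a , pred a + + Δ) → Linked G Δ v w (a , b)
                 → Linked G Δ v w (pred a , b)
  Linked-extendˡ {v} {w} {a} e l τ (a-1≤τ , τ≤b-Δ) with τ ≤? pred a
  ... | yes τ≤a-1 = subst (λ x → EdgeIn v w (x , x + + Δ)) (≤-antisym a-1≤τ τ≤a-1) e
  ... | no τ≰a-1 = l τ (subst (_≤ τ) (suc-pred a) (≰⇒suc≤ τ≰a-1) , τ≤b-Δ)

  Linked-extendʳ : EdgeIn v w (sucℤ b - + Δ , sucℤ b - + Δ + + Δ) → Linked G Δ v w (a , b)
                 → Linked G Δ v w (a , sucℤ b)
  Linked-extendʳ {v} {w} {b} e l τ (a≤τ , τ≤) with τ ≤? b - + Δ
  ... | yes τ≤b-Δ = l τ (a≤τ , τ≤b-Δ)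
  ... | no τ≰b-Δ = subst (λ x → EdgeIn v w (x , x + + Δ))
                     (≤-antisym (subst (_≤ τ) (suc[i-j]≡suc[i]-j b (+ Δ)) (≰⇒suc≤ τ≰b-Δ)) τ≤) e
    where
    suc[i-j]≡suc[i]-j : ∀ i j → 1ℤ + (i - j) ≡ (1ℤ + i) - j
    suc[i-j]≡suc[i]-j = solve-∀

  Linked-extendˡ? : Linked G Δ v w (a , b) → Dec (Linked G Δ v w (pred a , b))
  Linked-extendˡ? {v} {w} {a} {b} l with EdgeIn? v w (pred a , pred a + + Δ) | pred a ≤? b - + Δ
  ... | yes e | _ = yes (Linked-extendˡ {b = b} e l)
  ... | no ¬e | yes a-1≤b-Δ = no (λ l′ → ¬e (l′ (pred a) (≤-refl , a-1≤b-Δ)))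
  ... | no _ | no a-1≰b-Δ = yes (Linked-vacuous {b = b} a-1≰b-Δ)

  Linked-extendʳ? : Linked G Δ v w (a , b) → Dec (Linked G Δ v w (a , sucℤ b))
  Linked-extendʳ? {v} {w} {a} {b} l
    with EdgeIn? v w (sucℤ b - + Δ , sucℤ b - + Δ + + Δ) | a ≤? sucℤ b - + Δ
  ... | yes e | _ = yes (Linked-extendʳ {b = b} e l)
  ... | no ¬e | yes a≤b+1-Δ = no (λ l′ → ¬e (l′ (sucℤ b - + Δ) (a≤b+1-Δ , ≤-refl)))
  ... | no _ | no a≰b+1-Δ = yes (Linked-vacuous {b = sucℤ b} a≰b+1-Δ)

  -- Push the left end of (a, b) down as far as the link survives, then the right end
  -- up; a longer linked interval would contradict one of the two stopping conditions.
  N-covers : (a , b) ⊆ᵢ (p , q) → Wide Δ (a , b) → Linked G Δ v w (a , b)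
           → ∃[ M ] (N G Δ v (p , q) (w , M) × (a , b) ⊆ᵢ M)
  N-covers {a} {b} {p} {q} {v} {w} ab⊆pq ab-wide l
    with ⊆ᵢ⇒bounds (wide⇒≤ {b = b} ab-wide) ab⊆pq
  ... | p≤a , b≤q
    with least-above {Q = λ c → Linked G Δ v w (c , b)} (Linked-extendˡ? {b = b}) p≤a l
  ... | c , p≤c , c≤a , l-c , c-least
    with greatest-below {Q = λ d → Linked G Δ v w (c , d)}
                        (λ {d} → Linked-extendʳ? {a = c} {b = d}) b≤q l-c
  ... | d , b≤d , d≤q , l-cd , d-greatest =
    (c , d) , (cd-wide , bounds⇒⊆ᵢ p≤c d≤q , l-cd , cd-maximal) , bounds⇒⊆ᵢ c≤a b≤d
    where
    cd-wide : Wide Δ (c , d)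
    cd-wide = Wide-mono ab-wide (bounds⇒⊆ᵢ c≤a b≤d)
    cd-maximal : ∀ J → Wide Δ J → J ⊆ᵢ (p , q) → Linked G Δ v w J → (c , d) ⊆ᵢ J → J ⊆ᵢ (c , d)
    cd-maximal (c′ , d′) J-wide J⊆pq l-J cd⊆J = bounds⇒⊆ᵢ c≤c′ d′≤d
      where
      c′≤c×d≤d′ : c′ ≤ c × d ≤ d′
      c′≤c×d≤d′ = ⊆ᵢ⇒bounds (wide⇒≤ {b = d} cd-wide) cd⊆J
      p≤c′×d′≤q : p ≤ c′ × d′ ≤ q
      p≤c′×d′≤q = ⊆ᵢ⇒bounds (wide⇒≤ {b = d′} J-wide) J⊆pq
      c≤c′ : c ≤ c′
      c≤c′ = ≮⇒≥ λ c′<c →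
        [ (λ c≡p → <⇒≱ c′<c (subst (_≤ c′) (sym c≡p) (proj₁ p≤c′×d′≤q)))
        , (λ ¬l → ¬l (Linked-⊆ᵢ {I = pred c , b}
                        (bounds⇒⊆ᵢ (i<j⇒i≤pred[j] c′<c) (≤-trans b≤d (proj₂ c′≤c×d≤d′))) l-J))
        ]′ c-least
      d′≤d : d′ ≤ d
      d′≤d = ≮⇒≥ λ d<d′ →
        [ (λ d≡q → <⇒≱ d<d′ (subst (d′ ≤_) (sym d≡q) (proj₂ p≤c′×d′≤q)))
        , (λ ¬l → ¬l (Linked-⊆ᵢ {I = c , sucℤ d}
                        (bounds⇒⊆ᵢ (proj₁ c′≤c×d≤d′) (i<j⇒suc[i]≤j d<d′)) l-J))
        ]′ d-greatest

  LinkedToAll : Subset n → Fin n → Interval → Set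
  LinkedToAll C w I = ∀ c → c ∈ₛ C → Linked G Δ c w I

  LinkedToAll-⊆ᵢ : I ⊆ᵢ J → LinkedToAll C w J → LinkedToAll C w I
  LinkedToAll-⊆ᵢ I⊆J l c c∈C = Linked-⊆ᵢ I⊆J (l c c∈C)

  LinkedToAll-glues : Glues Δ (LinkedToAll C w)
  LinkedToAll-glues K-wide K⊆I K⊆J l₁ l₂ c c∈C = Linked-glues K-wide K⊆I K⊆J (l₁ c c∈C) (l₂ c c∈C)

  LinkedToAll-∪⁅⁆⁻ : LinkedToAll (C ∪ ⁅ v ⁆) w I → LinkedToAll C w I × Linked G Δ v w I
  LinkedToAll-∪⁅⁆⁻ l = (λ c → l c ∘ x∈p⇒x∈p∪⁅y⁆) , l _ y∈p∪⁅y⁆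

  LinkedToAll-∪⁅⁆⁺ : LinkedToAll C w I → Linked G Δ v w I → LinkedToAll (C ∪ ⁅ v ⁆) w I
  LinkedToAll-∪⁅⁆⁺ l-C l-v c c∈ with x∈p∪⁅y⁆⁻ c∈
  ... | inj₁ c∈C = l-C c c∈C
  ... | inj₂ refl = l-v

  IsΔClique-⊆ᵢ : Wide Δ J → J ⊆ᵢ I → IsΔClique G Δ (C , I) → IsΔClique G Δ (C , J)
  IsΔClique-⊆ᵢ J-wide J⊆I (_ , I⊆T , link) =
    J-wide , ⊆ᵢ-trans J⊆I I⊆T , λ x y x∈C y∈C x≢y → Linked-⊆ᵢ J⊆I (link x y x∈C y∈C x≢y)

  IsΔClique-⊆ₛ : C′ ⊆ₛ C → IsΔClique G Δ (C , I) → IsΔClique G Δ (C′ , I)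
  IsΔClique-⊆ₛ C′⊆C (I-wide , I⊆T , link) = I-wide , I⊆T , λ x y x∈ y∈ → link x y (C′⊆C x∈) (C′⊆C y∈)

  IsΔClique-add : IsΔClique G Δ (C , I) → LinkedToAll C v I → IsΔClique G Δ (C ∪ ⁅ v ⁆ , I)
  IsΔClique-add {C} {I} {v} (I-wide , I⊆T , link) l = I-wide , I⊆T , link′
    where
    link′ : ∀ x y → x ∈ₛ C ∪ ⁅ v ⁆ → y ∈ₛ C ∪ ⁅ v ⁆ → x ≢ y → Linked G Δ x y I
    link′ x y x∈ y∈ x≢y with x∈p∪⁅y⁆⁻ x∈ | x∈p∪⁅y⁆⁻ y∈
    ... | inj₁ x∈C | inj₁ y∈C = link x y x∈C y∈C x≢y
    ... | inj₁ x∈C | inj₂ refl = l x x∈C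
    ... | inj₂ refl | inj₁ y∈C = Linked-sym {I = I} (l y y∈C)
    ... | inj₂ refl | inj₂ refl = contradiction refl x≢y

  IsΔClique-glues : Glues Δ (λ I → IsΔClique G Δ (C , I))
  IsΔClique-glues {I = I} {J} K-wide K⊆I K⊆J (I-wide , I⊆T , link₁) (J-wide , J⊆T , link₂) =
    Wide-mono I-wide (⊆ᵢ-hullˡ I J) , hull-least I-wide J-wide I⊆T J⊆T ,
    λ x y x∈C y∈C x≢y → Linked-glues K-wide K⊆I K⊆J (link₁ x y x∈C y∈C x≢y) (link₂ x y x∈C y∈C x≢y)

  -- A larger clique (C′, I′) ⊇ (C ∪ {v}, J) glues with (C, I) along J; time-maximality of
  -- (C, I) keeps the hull inside I, and then I′ ⊆ J by maximality of J.
  TimeMaximal-extend : TimeMaximal G Δ (C , I) → v ∉ₛ C → MaximalIn Δ (LinkedToAll C v) J I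
                     → TimeMaximal G Δ (C ∪ ⁅ v ⁆ , J)
  TimeMaximal-extend {C} {I} {v} {J} (clique , maximal) v∉C (J-wide , J⊆I , l-J , J-max) =
    IsΔClique-add (IsΔClique-⊆ᵢ J-wide J⊆I clique) l-J , no-larger
    where
    no-larger : ∀ C′ I′ → IsΔClique G Δ (C′ , I′) → J ⊊ᵢ I′ → ¬ (C ∪ ⁅ v ⁆ ⊆ₛ C′)
    no-larger C′ I′ clique′@(I′-wide , _ , link′) (J⊆I′ , I′⊈J) Cv⊆C′ =
      maximal C (hull I I′) glued (⊆ᵢ-hullˡ I I′ , I′⊈J ∘ I′⊆J ∘ ⊆ᵢ-trans (⊆ᵢ-hullʳ I I′)) (λ c∈C → c∈C)
      where
      glued : IsΔClique G Δ (C , hull I I′)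
      glued = IsΔClique-glues J-wide J⊆I J⊆I′ clique (IsΔClique-⊆ₛ (Cv⊆C′ ∘ x∈p⇒x∈p∪⁅y⁆) clique′)
      I′⊆J : I′ ⊆ᵢ I → I′ ⊆ᵢ J
      I′⊆J I′⊆I = J-max I′ I′-wide I′⊆I
        (λ c c∈C → link′ c v (Cv⊆C′ (x∈p⇒x∈p∪⁅y⁆ c∈C)) (Cv⊆C′ y∈p∪⁅y⁆) λ { refl → v∉C c∈C }) J⊆I′

  -- N v I′ (w , M) unfolds to MaximalIn Δ (Linked G Δ v w) M I′.
  MaximalIn-∩N : w ∉ₛ C → MaximalIn Δ (LinkedToAll C w) J I → N G Δ v I′ (w , M) → I′ ⊆ᵢ I
               → Wide Δ (J ∩ᵢ M) → w ∉ₛ C ∪ ⁅ v ⁆ × MaximalIn Δ (LinkedToAll (C ∪ ⁅ v ⁆) w) (J ∩ᵢ M) I′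
  MaximalIn-∩N {w} {C} {J} {I} {v} {I′} {M}
               w∉C J-max@(_ , _ , l-J , _) M-max@(M-wide , M⊆I′ , l-M , _) I′⊆I JM-wide =
    w∉Cv , JM-wide , ⊆ᵢ-trans (∩ᵢ-⊆ʳ J M) M⊆I′ ,
    LinkedToAll-∪⁅⁆⁺ {I = J ∩ᵢ M} (LinkedToAll-⊆ᵢ (∩ᵢ-⊆ˡ J M) l-J) (Linked-⊆ᵢ (∩ᵢ-⊆ʳ J M) l-M) , JM-max
    where
    w∉Cv : w ∉ₛ C ∪ ⁅ v ⁆
    w∉Cv w∈ with x∈p∪⁅y⁆⁻ w∈
    ... | inj₁ w∈C = w∉C w∈C
    ... | inj₂ refl = Linked-irrefl {I = M} M-wide l-M
    JM-max : ∀ L → Wide Δ L → L ⊆ᵢ I′ → LinkedToAll (C ∪ ⁅ v ⁆) w L → (J ∩ᵢ M) ⊆ᵢ L → L ⊆ᵢ (J ∩ᵢ M)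
    JM-max L L-wide L⊆I′ l-L JM⊆L =
      ∩ᵢ-greatest
        (MaximalIn-absorb Δ {L = L} (LinkedToAll-glues {C = C} {w}) J-max
                          L-wide (⊆ᵢ-trans L⊆I′ I′⊆I) (proj₁ l-Cv) JM-wide JM⊆L (∩ᵢ-⊆ˡ J M))
        (MaximalIn-absorb Δ {L = L} (Linked-glues {v} {w}) M-max
                          L-wide L⊆I′ (proj₂ l-Cv) JM-wide JM⊆L (∩ᵢ-⊆ʳ J M))
      where
      l-Cv : LinkedToAll C w L × Linked G Δ v w L
      l-Cv = LinkedToAll-∪⁅⁆⁻ {C = C} {v} {w} {L} l-L

  ∈-⊓Δ : Z (w , M) → Wide Δ (J ∩ᵢ M) → Y (w , J) → _⊓Δ_ G Δ Y Z (w , J ∩ᵢ M)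
  ∈-⊓Δ {M = M} {J = J} ZM JM-wide YJ = J , M , YJ , ZM , refl , JM-wide

  Candidates : VISet G Δ → Subset n → Interval → VISet G Δ → Set
  Candidates P C I X = ∀ w J → P (w , J) ⊎ X (w , J) → w ∉ₛ C × MaximalIn Δ (LinkedToAll C w) J I

  Covers : VISet G Δ → Subset n → Interval → VISet G Δ → Set
  Covers P C I X = ∀ w L → w ∉ₛ C → Wide Δ L → L ⊆ᵢ I → LinkedToAll C w L
                 → ∃[ J ] ((P (w , J) ⊎ X (w , J)) × L ⊆ᵢ J)

  record Invariant (P : VISet G Δ) (C : Subset n) (I : Interval) (X : VISet G Δ) : Set where
    field
      time-maximal : TimeMaximal G Δ (C , I)
      candidate    : Candidates P C I X
      covered      : Covers P C I X

  invariant-root : Wide Δ (T G Δ) → Invariant (P₀ G Δ) ∅ (T G Δ) (X₀ G Δ)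
  invariant-root T-wide = record
    { time-maximal = (T-wide , ⊆ᵢ-refl , λ _ _ x∈⊥ → contradiction x∈⊥ ∉⊥)
                   , λ { _ _ (_ , I′⊆T , _) (_ , I′⊈T) _ → I′⊈T I′⊆T }
    ; candidate = λ { w J (inj₁ refl) →
        ∉⊥ , T-wide , ⊆ᵢ-refl , (λ _ c∈⊥ → contradiction c∈⊥ ∉⊥) , λ _ _ L⊆T _ _ → L⊆T }
    ; covered = λ w L _ _ L⊆T _ → T G Δ , inj₁ refl , L⊆T
    }

  invariant-next : Invariant P C I X → P (v , I′)
                 → Invariant (_∖ₛ_ G Δ P (v , I′)) C I (_∪ₛ_ G Δ X (v , I′))
  invariant-next {P} {C} {I} {X} {v} {I′} inv Pv = record
    { time-maximal = time-maximal ; candidate = candidate′ ; covered = covered′ }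
    where
    open Invariant inv
    candidate′ : Candidates (_∖ₛ_ G Δ P (v , I′)) C I (_∪ₛ_ G Δ X (v , I′))
    candidate′ w J (inj₁ (PJ , _)) = candidate w J (inj₁ PJ)
    candidate′ w J (inj₂ (inj₁ XJ)) = candidate w J (inj₂ XJ)
    candidate′ w J (inj₂ (inj₂ refl)) = candidate v I′ (inj₁ Pv)
    covered′ : Covers (_∖ₛ_ G Δ P (v , I′)) C I (_∪ₛ_ G Δ X (v , I′))
    covered′ w L w∉C L-wide L⊆I l-L with covered w L w∉C L-wide L⊆I l-L
    ... | J , inj₂ XJ , L⊆J = J , inj₂ (inj₁ XJ) , L⊆J
    ... | J , inj₁ PJ , L⊆J with ≡-dec Fin._≟_ (≡-dec _≟_ _≟_) (w , J) (v , I′)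
    ...   | yes wJ≡vI′ = J , inj₂ (inj₂ wJ≡vI′) , L⊆J
    ...   | no wJ≢vI′ = J , inj₁ (PJ , wJ≢vI′) , L⊆J

  invariant-child : Invariant P C I X → P (v , I′)
                  → Invariant (_⊓Δ_ G Δ P (N G Δ v I′)) (C ∪ ⁅ v ⁆) I′ (_⊓Δ_ G Δ X (N G Δ v I′))
  invariant-child {P} {C} {I} {X} {v} {I′} inv Pv = record
    { time-maximal = TimeMaximal-extend time-maximal (proj₁ v-candidate) (proj₂ v-candidate)
    ; candidate = candidate′ ; covered = covered′ }
    where
    open Invariant inv
    v-candidate : v ∉ₛ C × MaximalIn Δ (LinkedToAll C v) I′ I
    v-candidate = candidate v I′ (inj₁ Pv)
    I′⊆I : I′ ⊆ᵢ I
    I′⊆I = proj₁ (proj₂ (proj₂ v-candidate))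
    candidate′ : Candidates (_⊓Δ_ G Δ P (N G Δ v I′)) (C ∪ ⁅ v ⁆) I′ (_⊓Δ_ G Δ X (N G Δ v I′))
    candidate′ w _ (inj₁ (J , M , PJ , NM , refl , JM-wide)) =
      let w∉C , J-max = candidate w J (inj₁ PJ) in MaximalIn-∩N w∉C J-max NM I′⊆I JM-wide
    candidate′ w _ (inj₂ (J , M , XJ , NM , refl , JM-wide)) =
      let w∉C , J-max = candidate w J (inj₂ XJ) in MaximalIn-∩N w∉C J-max NM I′⊆I JM-wide
    covered′ : Covers (_⊓Δ_ G Δ P (N G Δ v I′)) (C ∪ ⁅ v ⁆) I′ (_⊓Δ_ G Δ X (N G Δ v I′))
    covered′ w L w∉Cv L-wide L⊆I′ l-L =
      cut (covered w L (w∉Cv ∘ x∈p⇒x∈p∪⁅y⁆) L-wide (⊆ᵢ-trans L⊆I′ I′⊆I) l-C) (N-covers L⊆I′ L-wide l-v)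
      where
      l-C : LinkedToAll C w L
      l-C = proj₁ (LinkedToAll-∪⁅⁆⁻ {C = C} {v} {w} {L} l-L)
      l-v : Linked G Δ v w L
      l-v = proj₂ (LinkedToAll-∪⁅⁆⁻ {C = C} {v} {w} {L} l-L)
      cut : ∃[ J ] ((P (w , J) ⊎ X (w , J)) × L ⊆ᵢ J) → ∃[ M ] (N G Δ v I′ (w , M) × L ⊆ᵢ M)
          → ∃[ J ] ((_⊓Δ_ G Δ P (N G Δ v I′) (w , J) ⊎ _⊓Δ_ G Δ X (N G Δ v I′) (w , J)) × L ⊆ᵢ J)
      cut (J , PXJ , L⊆J) (M , NM , L⊆M) =
        J ∩ᵢ M , Sum.map (∈-⊓Δ {Z = N G Δ v I′} {w} {M} {J} {P} NM JM-wide)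
                         (∈-⊓Δ {Z = N G Δ v I′} {w} {M} {J} {X} NM JM-wide) PXJ , L⊆JM
        where
        L⊆JM : L ⊆ᵢ (J ∩ᵢ M)
        L⊆JM = ∩ᵢ-greatest L⊆J L⊆M
        JM-wide : Wide Δ (J ∩ᵢ M)
        JM-wide = Wide-mono {I = L} L-wide L⊆JM

  report⇒maximal : Invariant P C I X → ReportCond G Δ P (C , I) X → MaximalΔClique G Δ (C , I)
  report⇒maximal {P} {C} {I} {X} inv report = (clique , vertex-maximal) , time-maximal
    where
    open Invariant inv
    clique : IsΔClique G Δ (C , I)
    clique = proj₁ time-maximal
    vertex-maximal : ∀ C′ I′ → IsΔClique G Δ (C′ , I′) → I ⊆ᵢ I′ → ¬ (C ⊂ₛ C′)
    vertex-maximal C′ I′ (_ , _ , link′) I⊆I′ (C⊆C′ , x , x∈C′ , x∉C)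
      with covered x I x∉C (proj₁ clique) ⊆ᵢ-refl
             (λ c c∈C → Linked-⊆ᵢ I⊆I′ (link′ c x (C⊆C′ c∈C) x∈C′ λ { refl → x∉C c∈C }))
    ... | J , PXJ , I⊆J = proj₂ (report x J PXJ) I⊆J

  maximal⇒report : Invariant P C I X → MaximalΔClique G Δ (C , I) → ReportCond G Δ P (C , I) X
  maximal⇒report {C = C} {I} inv ((clique , vertex-maximal) , _) w J PXJ
    with Invariant.candidate inv w J PXJ
  ... | w∉C , _ , J⊆I , l-J , _ =
    J⊆I , λ I⊆J → vertex-maximal (C ∪ ⁅ w ⁆) I (IsΔClique-add clique (LinkedToAll-⊆ᵢ I⊆J l-J)) ⊆ᵢ-refl
                    (x∈p⇒x∈p∪⁅y⁆ , w , y∈p∪⁅y⁆ , w∉C)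

  reported : Invariant P C I X → MaximalΔClique G Δ (C , I) → BK G Δ P (C , I) X out → (C , I) ∈ out
  reported _ _ (bk-report _ _) = here refl
  reported inv maximal (bk-skip no-report _) = contradiction (maximal⇒report inv maximal) no-report

  mutual
    sound-BK : Invariant P C I X → BK G Δ P (C , I) X out → ∀ {K} → K ∈ out → MaximalΔClique G Δ K
    sound-BK inv (bk-report report _) (here refl) = report⇒maximal inv report
    sound-BK inv (bk-report _ loop) (there K∈out) = sound-Loop inv loop K∈out
    sound-BK inv (bk-skip _ loop) K∈out = sound-Loop inv loop K∈out

    sound-Loop : Invariant P C I X → Loop G Δ P (C , I) X out → ∀ {K} → K ∈ out → MaximalΔClique G Δ K
    sound-Loop _ (loop-done _) ()
    sound-Loop inv (loop-step {out₁ = out₁} v I′ Pv bk loop) K∈out with ∈-++⁻ out₁ K∈out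
    ... | inj₁ K∈out₁ = sound-BK (invariant-child inv Pv) bk K∈out₁
    ... | inj₂ K∈out₂ = sound-Loop (invariant-next inv Pv) loop K∈out₂

  -- The state of a call on the way to the maximal clique (KC , KI).
  record Towards (KC : Subset n) (KI : Interval)
                 (P : VISet G Δ) (C : Subset n) (I : Interval) (X : VISet G Δ) : Set where
    field
      vertices⊆ : C ⊆ₛ KC
      interval⊆ : KI ⊆ᵢ I
      P-covers  : ∀ w → w ∈ₛ KC → w ∉ₛ C → ∃[ J ] (P (w , J) × KI ⊆ᵢ J)
      X-misses  : ∀ w J → w ∈ₛ KC → w ∉ₛ C → X (w , J) → ¬ (KI ⊆ᵢ J)

  towards-root : MaximalΔClique G Δ (KC , KI) → Towards KC KI (P₀ G Δ) ∅ (T G Δ) (X₀ G Δ)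
  towards-root (((_ , KI⊆T , _) , _) , _) = record
    { vertices⊆ = λ x∈∅ → contradiction x∈∅ ∉⊥
    ; interval⊆ = KI⊆T
    ; P-covers = λ _ _ _ → T G Δ , refl , KI⊆T
    ; X-misses = λ _ _ _ _ ()
    }

  towards-next : Towards KC KI P C I X → ¬ (v ∈ₛ KC × KI ⊆ᵢ I′)
               → Towards KC KI (_∖ₛ_ G Δ P (v , I′)) C I (_∪ₛ_ G Δ X (v , I′))
  towards-next {KC} {KI} {P} {C} {I} {X} {v} {I′} tw skipped = record
    { vertices⊆ = vertices⊆ ; interval⊆ = interval⊆ ; P-covers = P-covers′ ; X-misses = X-misses′ }
    where
    open Towards tw
    P-covers′ : ∀ w → w ∈ₛ KC → w ∉ₛ C → ∃[ J ] (_∖ₛ_ G Δ P (v , I′) (w , J) × KI ⊆ᵢ J)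
    P-covers′ w w∈KC w∉C with P-covers w w∈KC w∉C
    ... | J , PJ , KI⊆J = J , (PJ , λ { refl → skipped (w∈KC , KI⊆J) }) , KI⊆J
    X-misses′ : ∀ w J → w ∈ₛ KC → w ∉ₛ C → _∪ₛ_ G Δ X (v , I′) (w , J) → ¬ (KI ⊆ᵢ J)
    X-misses′ w J w∈KC w∉C (inj₁ XJ) = X-misses w J w∈KC w∉C XJ
    X-misses′ w J w∈KC w∉C (inj₂ refl) KI⊆J = skipped (w∈KC , KI⊆J)

  towards-child : MaximalΔClique G Δ (KC , KI) → Towards KC KI P C I X → v ∈ₛ KC → KI ⊆ᵢ I′
                → Towards KC KI (_⊓Δ_ G Δ P (N G Δ v I′)) (C ∪ ⁅ v ⁆) I′ (_⊓Δ_ G Δ X (N G Δ v I′))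
  towards-child {KC} {KI} {P} {C} {I} {X} {v} {I′} (((KI-wide , _ , link) , _) , _) tw v∈KC KI⊆I′ =
    record
      { vertices⊆ = λ x∈ → [ vertices⊆ , (λ { refl → v∈KC }) ]′ (x∈p∪⁅y⁆⁻ x∈)
      ; interval⊆ = KI⊆I′ ; P-covers = P-covers′ ; X-misses = X-misses′ }
    where
    open Towards tw
    P-covers′ : ∀ w → w ∈ₛ KC → w ∉ₛ C ∪ ⁅ v ⁆ → ∃[ J ] (_⊓Δ_ G Δ P (N G Δ v I′) (w , J) × KI ⊆ᵢ J)
    P-covers′ w w∈KC w∉Cv =
      cut (P-covers w w∈KC (w∉Cv ∘ x∈p⇒x∈p∪⁅y⁆))
          (N-covers KI⊆I′ KI-wide (link v w v∈KC w∈KC λ { refl → w∉Cv y∈p∪⁅y⁆ }))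
      where
      cut : ∃[ J ] (P (w , J) × KI ⊆ᵢ J) → ∃[ M ] (N G Δ v I′ (w , M) × KI ⊆ᵢ M)
          → ∃[ J ] (_⊓Δ_ G Δ P (N G Δ v I′) (w , J) × KI ⊆ᵢ J)
      cut (J , PJ , KI⊆J) (M , NM , KI⊆M) =
        J ∩ᵢ M , ∈-⊓Δ {Z = N G Δ v I′} {w} {M} {J} {P} NM (Wide-mono {I = KI} KI-wide KI⊆JM) PJ , KI⊆JM
        where
        KI⊆JM : KI ⊆ᵢ (J ∩ᵢ M)
        KI⊆JM = ∩ᵢ-greatest KI⊆J KI⊆M
    X-misses′ : ∀ w J → w ∈ₛ KC → w ∉ₛ C ∪ ⁅ v ⁆ → _⊓Δ_ G Δ X (N G Δ v I′) (w , J) → ¬ (KI ⊆ᵢ J)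
    X-misses′ w _ w∈KC w∉Cv (J , M , XJ , _ , refl , _) KI⊆JM =
      X-misses w J w∈KC (w∉Cv ∘ x∈p⇒x∈p∪⁅y⁆) XJ (⊆ᵢ-trans KI⊆JM (∩ᵢ-⊆ˡ J M))

  towards-reached : Invariant P C I X → MaximalΔClique G Δ (KC , KI) → Towards KC KI P C I X
                  → KC ⊆ₛ C → (KC , KI) ≡ (C , I)
  towards-reached {C = C} {I} {KI = KI} inv (((KI-wide , _) , _) , _ , K-time-maximal) tw KC⊆C =
    cong₂ _,_ (⊆-antisym KC⊆C vertices⊆) (⊆ᵢ-antisym KI-wide (proj₁ clique) interval⊆ I⊆KI)
    where
    open Towards tw
    clique : IsΔClique G Δ (C , I)
    clique = proj₁ (Invariant.time-maximal inv)
    I⊆KI : I ⊆ᵢ KI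
    I⊆KI = decidable-stable (I ⊆ᵢ? KI) λ I⊈KI → K-time-maximal C I clique (interval⊆ , I⊈KI) KC⊆C

  mutual
    complete-BK : Invariant P C I X → MaximalΔClique G Δ (KC , KI) → Towards KC KI P C I X
                → BK G Δ P (C , I) X out → (KC , KI) ∈ out
    complete-BK {C = C} {KC = KC} inv maximal tw bk with KC ⊆? C
    ... | yes KC⊆C with towards-reached inv maximal tw KC⊆C
    ...   | refl = reported inv maximal bk
    complete-BK inv maximal tw (bk-report _ loop) | no KC⊈C =
      there (complete-Loop inv maximal tw KC⊈C loop)
    complete-BK inv maximal tw (bk-skip _ loop) | no KC⊈C = complete-Loop inv maximal tw KC⊈C loop

    complete-Loop : Invariant P C I X → MaximalΔClique G Δ (KC , KI) → Towards KC KI P C I X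
                  → ¬ (KC ⊆ₛ C) → Loop G Δ P (C , I) X out → (KC , KI) ∈ out
    complete-Loop _ _ tw KC⊈C (loop-done P-empty) with ⊈⇒∃∉ KC⊈C
    ... | w , w∈KC , w∉C with Towards.P-covers tw w w∈KC w∉C
    ...   | J , PJ , _ = contradiction PJ (P-empty (w , J))
    complete-Loop {KC = KC} {KI = KI} inv maximal tw KC⊈C (loop-step {out₁ = out₁} v I′ Pv bk loop)
      with v ∈? KC | KI ⊆ᵢ? I′
    ... | yes v∈KC | yes KI⊆I′ =
      ∈-++⁺ˡ (complete-BK (invariant-child inv Pv) maximal (towards-child maximal tw v∈KC KI⊆I′) bk)
    ... | no v∉KC | _ =
      ∈-++⁺ʳ out₁ (complete-Loop (invariant-next inv Pv) maximal (towards-next tw (v∉KC ∘ proj₁)) KC⊈C loop)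
    ... | yes _ | no KI⊈I′ =
      ∈-++⁺ʳ out₁ (complete-Loop (invariant-next inv Pv) maximal (towards-next tw (KI⊈I′ ∘ proj₂)) KC⊈C loop)

theorem1 : (G : TemporalGraph) (Δ : ℕ)
    → + Δ ≤ TemporalGraph.ω G - TemporalGraph.α G
    → (out : List (Clq G Δ))
    → BK G Δ (P₀ G Δ) (R₀ G Δ) (X₀ G Δ) out
    → (K : Clq G Δ) → (K ∈ out) ⇔ MaximalΔClique G Δ K
theorem1 G Δ T-wide out bk K =
  mk⇔ (sound-BK G Δ root bk)
      (λ K-maximal → complete-BK G Δ root K-maximal (towards-root G Δ K-maximal) bk)
  where root = invariant-root G Δ T-wide
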